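{- For any SDD $\alpha$ defined with vtree $v$, there exists a VS-SDD $(\beta,k)$ with respect to $v$ such that $\langle\beta,k\rangle=\langle\alpha\rangle$ and $|\beta|\le|\alpha|$.
   Context: A vtree over a set of variables is an ordered full binary tree whose leaves are in one-to-one correspondence with the variables; $l(x)$ is the variable of leaf $x$; nodes have integer IDs $\mathtt{ID}(x)$ assigned in preorder, $\mathtt{ID}^{ -1}(i)$ the node with ID $i$. $y$ is a left (right) descendant of $x$ if it is a (not necessarily proper) descendant of the left (right) child of $x$. For disjoint $\mathbf{X},\mathbf{Y}$, functions $p_1(\mathbf{X}),\ldots,p_n(\mathbf{X})$ form a partition if pairwise conjunctions are false, their disjunction is true, and none is false. SDD (respecting vtree node $x$): $\top,\bot$ (semantics true/false); literals $X$ or $\neg X$ where $x$ is the leaf of $X$; decompositions $\{(p_1,s_1),\ldots,(p_n,s_n)\}$ with $x$ internal, each $p_i$ an SDD respecting a left descendant of $x$, each $s_i$ an SDD respecting a right descendant of $x$, $\langle p_i\rangle$ forming a partition, semantics $\bigvee_i\langle p_i\rangle\wedge\langle s_i\rangle$. Identical substructures are merged. Size = sum over decomposition nodes of the number of elements $n$. A VS-SDD is a pair $(\alpha,k)$ of a structure and integer offset with semantics: $\top,\bot$ as constants; literal $\mathbf{v}$ ($\neg\mathbf{v}$) with $\mathtt{ID}^{ -1}(k)$ a leaf means $l(\mathtt{ID}^{ -1}(k))$ (its negation); decomposition $\{([p_i,d_i],[s_i,e_i])\}_{i=1}^n$ with $\mathtt{ID}^{ -1}(k)$ internal, $\mathtt{ID}^{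 -1}(d_i+k)$ a left and $\mathtt{ID}^{ -1}(e_i+k)$ a right descendant of $\mathtt{ID}^{ -1}(k)$, $\langle p_i,d_i+k\rangle$ forming a partition, meaning $\bigvee_i\langle p_i,d_i+k\rangle\wedge\langle s_i,e_i+k\rangle$. Structures are DAG nodes; identical structures are shared only when their offsets correspond to vtree nodes with isomorphic subtrees. Size $|\beta|$ = sum over distinct decomposition nodes of the number of elements. -}

module Defs where

open import Data.Nat using (ℕ; zero; suc; _+_; _∸_; _<ᵇ_)
import Data.Nat.Properties as ℕP
open import Data.Integer using (ℤ; +_; -[1+_]) renaming (_+_ to _+ℤ_)
import Data.Integer.Properties as ℤP
open import Data.Bool using (Bool; true; false; _∧_; _∨_; not; if_then_else_)
import Data.Bool.Properties as BP
open import Data.List using (List; []; _∷_; _++_; length; map; lookup; deduplicate)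
open import Data.Bool.ListAction using (any)
open import Data.Nat.ListAction using (sum)
open import Data.List.Relation.Unary.Unique.Propositional using (Unique)
open import Data.Maybe using (Maybe; just; nothing; _>>=_) renaming (map to mapMaybe)
import Data.Maybe.Properties as MP
open import Data.Product using (_×_; _,_; Σ; Σ-syntax; ∃; ∃₂; proj₁; proj₂)
import Data.Product.Properties as PP
open import Data.Unit using (⊤; tt)
open import Data.Fin using (Fin)
open import Relation.Binary.PropositionalEquality using (_≡_; _≢_; refl)
open import Relation.Binary.Definitions using (DecidableEquality)
open import Relation.Nullary using (yes; no)

Var : Set
Var = ℕ

Assignment : Set
Assignment = Var → Bool

BoolFun : Set
BoolFun = Assignment → Bool

data VTree : Set where
  leaf : Var → VTree
  node : VTree → VTree → VTree

vars : VTree → List Var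
vars (leaf x)   = x ∷ []
vars (node l r) = vars l ++ vars r

WellFormedVTree : VTree → Set
WellFormedVTree v = Unique (vars v)

#nodes : VTree → ℕ
#nodes (leaf _)   = 1
#nodes (node l r) = suc (#nodes l + #nodes r)

-- nodes of a vtree are addressed by paths from the root
data Dir : Set where
  L R : Dir

Path : Set
Path = List Dir

subAt : VTree → Path → Maybe VTree
subAt t          []      = just t
subAt (leaf _)   (_ ∷ _) = nothing
subAt (node l r) (L ∷ p) = subAt l p
subAt (node l r) (R ∷ p) = subAt r p

-- ID⁻¹ for preorder IDs starting at 0 at the root:
-- root = 0, then the left subtree (IDs 1 … #nodes l), then the right subtree.
ID⁻¹ℕ : VTree → ℕ → Maybe Path
ID⁻¹ℕ t          zero    = just []
ID⁻¹ℕ (leaf _)   (suc n) = nothing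
ID⁻¹ℕ (node l r) (suc n) =
  if n <ᵇ #nodes l then mapMaybe (L ∷_) (ID⁻¹ℕ l n)
                   else mapMaybe (R ∷_) (ID⁻¹ℕ r (n ∸ #nodes l))

ID⁻¹ : VTree → ℤ → Maybe Path
ID⁻¹ t (+ n)    = ID⁻¹ℕ t n
ID⁻¹ t -[1+ _ ] = nothing

nodeAt : VTree → ℤ → Maybe VTree
nodeAt t k = ID⁻¹ t k >>= subAt t

LeftDesc : Path → Path → Set
LeftDesc x y = ∃ λ w → y ≡ x ++ (L ∷ w)

RightDesc : Path → Path → Set
RightDesc x y = ∃ λ w → y ≡ x ++ (R ∷ w)

-- shape of a vtree (for isomorphism of ordered trees, ignoring labels)
data Shape : Set where
  sleaf : Shape
  snode : Shape → Shape → Shape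

shape : VTree → Shape
shape (leaf _)   = sleaf
shape (node l r) = snode (shape l) (shape r)

Partition : List BoolFun → Set
Partition ps =
  (∀ (i j : Fin (length ps)) → i ≢ j → ∀ a → (lookup ps i a ∧ lookup ps j a) ≡ false)
  × (∀ a → any (λ p → p a) ps ≡ true)
  × (∀ (i : Fin (length ps)) → ∃ λ a → lookup ps i a ≡ true)

-- SDDs (as terms; identical substructures are identified, i.e. merged)

data SDD : Set where
  ⊤ₛ ⊥ₛ : SDD
  lit   : Bool → Var → SDD          -- lit true X = X ,  lit false X = ¬X
  dec   : List (SDD × SDD) → SDD

mutual
  ⟦_⟧ : SDD → BoolFun
  ⟦ ⊤ₛ ⟧ a        = true
  ⟦ ⊥ₛ ⟧ a        = false
  ⟦ lit b X ⟧ a   = if b then a X else not (a X)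
  ⟦ dec es ⟧ a    = ⟦ es ⟧ᴱ a

  ⟦_⟧ᴱ : List (SDD × SDD) → BoolFun
  ⟦ [] ⟧ᴱ a            = false
  ⟦ (p , s) ∷ es ⟧ᴱ a  = (⟦ p ⟧ a ∧ ⟦ s ⟧ a) ∨ ⟦ es ⟧ᴱ a

primesS : List (SDD × SDD) → List BoolFun
primesS es = map (λ e → ⟦ proj₁ e ⟧) es

mutual
  RespectsS : VTree → Path → SDD → Set
  RespectsS v x ⊤ₛ        = ∃ λ t → subAt v x ≡ just t
  RespectsS v x ⊥ₛ        = ∃ λ t → subAt v x ≡ just t
  RespectsS v x (lit b X) = subAt v x ≡ just (leaf X)
  RespectsS v x (dec es)  =
    (∃₂ λ l r → subAt v x ≡ just (node l r))
    × RespectsE v x es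
    × Partition (primesS es)

  RespectsE : VTree → Path → List (SDD × SDD) → Set
  RespectsE v x []             = ⊤
  RespectsE v x ((p , s) ∷ es) =
    (Σ[ y ∈ Path ] LeftDesc x y × RespectsS v y p)
    × (Σ[ z ∈ Path ] RightDesc x z × RespectsS v z s)
    × RespectsE v x es

mutual
  _≟S_ : DecidableEquality SDD
  ⊤ₛ ≟S ⊤ₛ = yes refl
  ⊤ₛ ≟S ⊥ₛ = no λ ()
  ⊤ₛ ≟S lit _ _ = no λ ()
  ⊤ₛ ≟S dec _ = no λ ()
  ⊥ₛ ≟S ⊤ₛ = no λ ()
  ⊥ₛ ≟S ⊥ₛ = yes refl
  ⊥ₛ ≟S lit _ _ = no λ ()
  ⊥ₛ ≟S dec _ = no λ ()
  lit _ _ ≟S ⊤ₛ = no λ ()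
  lit _ _ ≟S ⊥ₛ = no λ ()
  lit b X ≟S lit c Y with b BP.≟ c | X ℕP.≟ Y
  ... | yes refl | yes refl = yes refl
  ... | no ne    | _        = no λ { refl → ne refl }
  ... | _        | no ne    = no λ { refl → ne refl }
  lit _ _ ≟S dec _ = no λ ()
  dec _ ≟S ⊤ₛ = no λ ()
  dec _ ≟S ⊥ₛ = no λ ()
  dec _ ≟S lit _ _ = no λ ()
  dec es ≟S dec fs with es ≟SE fs
  ... | yes refl = yes refl
  ... | no ne    = no λ { refl → ne refl }

  _≟SE_ : DecidableEquality (List (SDD × SDD))
  [] ≟SE [] = yes refl
  [] ≟SE (_ ∷ _) = no λ ()
  (_ ∷ _) ≟SE [] = no λ ()
  ((p , s) ∷ es) ≟SE ((q , t) ∷ fs) with p ≟S q | s ≟S t | es ≟SE fs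
  ... | yes refl | yes refl | yes refl = yes refl
  ... | no ne    | _        | _        = no λ { refl → ne refl }
  ... | _        | no ne    | _        = no λ { refl → ne refl }
  ... | _        | _        | no ne    = no λ { refl → ne refl }

mutual
  decsS : SDD → List SDD
  decsS (dec es) = dec es ∷ decsE es
  decsS _        = []

  decsE : List (SDD × SDD) → List SDD
  decsE []             = []
  decsE ((p , s) ∷ es) = decsS p ++ decsS s ++ decsE es

#elemsS : SDD → ℕ
#elemsS (dec es) = length es
#elemsS _        = 0

sizeS : SDD → ℕ
sizeS α = sum (map #elemsS (deduplicate _≟S_ (decsS α)))

data VS : Set where
  ⊤ᵥ ⊥ᵥ : VS
  vlit  : Bool → VS                          -- vlit true = 𝐯 , vlit false = ¬𝐯
  vdec  : List ((VS × ℤ) × (VS × ℤ)) → VS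

VElem : Set
VElem = (VS × ℤ) × (VS × ℤ)

module _ (v : VTree) where

  -- semantics ⟨β,k⟩ (meaningful when IsVS v β k holds)
  mutual
    ⟨_,_⟩ : VS → ℤ → BoolFun
    ⟨ ⊤ᵥ , k ⟩ a     = true
    ⟨ ⊥ᵥ , k ⟩ a     = false
    ⟨ vlit b , k ⟩ a with nodeAt v k
    ... | just (leaf X) = if b then a X else not (a X)
    ... | _             = false
    ⟨ vdec es , k ⟩ a = ⟨ es , k ⟩ᴱ a

    ⟨_,_⟩ᴱ : List VElem → ℤ → BoolFun
    ⟨ [] , k ⟩ᴱ a = false
    ⟨ ((p , d) , (s , e)) ∷ es , k ⟩ᴱ a =
      (⟨ p , d +ℤ k ⟩ a ∧ ⟨ s , e +ℤ k ⟩ a) ∨ ⟨ es , k ⟩ᴱ a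

  primesV : List VElem → ℤ → List BoolFun
  primesV es k = map (λ el → ⟨ proj₁ (proj₁ el) , proj₂ (proj₁ el) +ℤ k ⟩) es

  mutual
    IsVS : VS → ℤ → Set
    IsVS ⊤ᵥ k       = ∃ λ x → ID⁻¹ v k ≡ just x
    IsVS ⊥ᵥ k       = ∃ λ x → ID⁻¹ v k ≡ just x
    IsVS (vlit b) k = ∃ λ X → nodeAt v k ≡ just (leaf X)
    IsVS (vdec es) k =
      Σ[ x ∈ Path ] ID⁻¹ v k ≡ just x
        × (∃₂ λ l r → subAt v x ≡ just (node l r))
        × IsVSE x k es
        × Partition (primesV es k)

    IsVSE : Path → ℤ → List VElem → Set
    IsVSE x k [] = ⊤
    IsVSE x k (((p , d) , (s , e)) ∷ es) =
      (Σ[ y ∈ Path ] ID⁻¹ v (d +ℤ k) ≡ just y × LeftDesc x y × IsVS p (d +ℤ k))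
      × (Σ[ z ∈ Path ] ID⁻¹ v (e +ℤ k) ≡ just z × RightDesc x z × IsVS s (e +ℤ k))
      × IsVSE x k es

  -- occurrences of decomposition structures, keyed by the structure and the
  -- shape of the vtree subtree at its absolute node: identical structures are
  -- shared exactly when their absolute nodes have isomorphic subtrees
  mutual
    occV : VS → ℤ → List (VS × Maybe Shape)
    occV (vdec es) k = (vdec es , mapMaybe shape (nodeAt v k)) ∷ occE es k
    occV _ k         = []

    occE : List VElem → ℤ → List (VS × Maybe Shape)
    occE [] k = []
    occE (((p , d) , (s , e)) ∷ es) k = occV p (d +ℤ k) ++ occV s (e +ℤ k) ++ occE es k

mutual
  _≟V_ : DecidableEquality VS
  ⊤ᵥ ≟V ⊤ᵥ = yes refl
  ⊤ᵥ ≟V ⊥ᵥ = no λ ()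
  ⊤ᵥ ≟V vlit _ = no λ ()
  ⊤ᵥ ≟V vdec _ = no λ ()
  ⊥ᵥ ≟V ⊤ᵥ = no λ ()
  ⊥ᵥ ≟V ⊥ᵥ = yes refl
  ⊥ᵥ ≟V vlit _ = no λ ()
  ⊥ᵥ ≟V vdec _ = no λ ()
  vlit _ ≟V ⊤ᵥ = no λ ()
  vlit _ ≟V ⊥ᵥ = no λ ()
  vlit b ≟V vlit c with b BP.≟ c
  ... | yes refl = yes refl
  ... | no ne    = no λ { refl → ne refl }
  vlit _ ≟V vdec _ = no λ ()
  vdec _ ≟V ⊤ᵥ = no λ ()
  vdec _ ≟V ⊥ᵥ = no λ ()
  vdec _ ≟V vlit _ = no λ ()
  vdec es ≟V vdec fs with es ≟VE fs
  ... | yes refl = yes refl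
  ... | no ne    = no λ { refl → ne refl }

  _≟VE_ : DecidableEquality (List VElem)
  [] ≟VE [] = yes refl
  [] ≟VE (_ ∷ _) = no λ ()
  (_ ∷ _) ≟VE [] = no λ ()
  (((p , d) , (s , e)) ∷ es) ≟VE (((q , d′) , (t , e′)) ∷ fs)
    with p ≟V q | d ℤP.≟ d′ | s ≟V t | e ℤP.≟ e′ | es ≟VE fs
  ... | yes refl | yes refl | yes refl | yes refl | yes refl = yes refl
  ... | no ne | _ | _ | _ | _ = no λ { refl → ne refl }
  ... | _ | no ne | _ | _ | _ = no λ { refl → ne refl }
  ... | _ | _ | no ne | _ | _ = no λ { refl → ne refl }
  ... | _ | _ | _ | no ne | _ = no λ { refl → ne refl }
  ... | _ | _ | _ | _ | no ne = no λ { refl → ne refl }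

_≟Shape_ : DecidableEquality Shape
sleaf ≟Shape sleaf = yes refl
sleaf ≟Shape snode _ _ = no λ ()
snode _ _ ≟Shape sleaf = no λ ()
snode a b ≟Shape snode c d with a ≟Shape c | b ≟Shape d
... | yes refl | yes refl = yes refl
... | no ne | _ = no λ { refl → ne refl }
... | _ | no ne = no λ { refl → ne refl }

_≟occ_ : DecidableEquality (VS × Maybe Shape)
_≟occ_ = PP.≡-dec _≟V_ (MP.≡-dec _≟Shape_)

#elemsV : VS → ℕ
#elemsV (vdec es) = length es
#elemsV _         = 0

sizeV : VTree → VS → ℤ → ℕ
sizeV v β k = sum (map (λ o → #elemsV (proj₁ o)) (deduplicate _≟occ_ (occV v β k)))

-- Every SDD γ that mentions a variable is translated at a vtree node anchor γ that depends on γ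
-- alone: a literal at its leaf, a decomposition at the deepest node whose left and right subtrees
-- contain the anchors of its primes and subs, respectively. Offsets are differences of preorder IDs
-- of anchors, and SDDs without literals become ⊤ or ⊥. Because both the structure and the node of
-- the translation of γ are functions of γ, every decomposition node of the VS-SDD is the image of a
-- decomposition subterm of α with the same number of elements, which bounds the size.
module Submission where

open import Defs
open import Data.Nat using (ℕ; suc; _<ᵇ_; _∸_; _+_; _≤_; _<_; z≤n; s≤s)
import Data.Nat.Properties as ℕP
open import Data.Nat.ListAction using (sum)
open import Data.Nat.ListAction.Properties using (sum-↭)
open import Data.Integer using (ℤ; +_; _⊖_) renaming (_+_ to _+ℤ_)
import Data.Integer.Properties as ℤP
open import Data.Bool using (Bool; true; false; _∧_; _∨_; if_then_else_; T)
open import Data.Bool.Properties using (T-∧)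
open import Data.Bool.ListAction using (any)
open import Data.List using (List; []; _∷_; _++_; length; map; lookup; deduplicate)
open import Data.List.Properties using (++-assoc; ++-identityʳ; map-∘)
open import Data.List.Membership.Propositional using (_∈_; _∉_)
open import Data.List.Membership.Propositional.Properties
  using (∈-++⁺ˡ; ∈-++⁺ʳ; ∈-++⁻; ∈-map⁺; ∈-∃++; ∈-deduplicate⁺; ∈-deduplicate⁻)
open import Data.List.Relation.Binary.Subset.Propositional using (_⊆_)
open import Data.List.Relation.Binary.Disjoint.Propositional using (Disjoint)
open import Data.List.Relation.Binary.Permutation.Propositional.Properties using (shift; map⁺)
open import Data.List.Relation.Binary.Pointwise using (Pointwise; []; _∷_; Pointwise-length; lookup-cast)
open import Data.List.Relation.Unary.All as All using (All; []; _∷_)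
import Data.List.Relation.Unary.All.Properties as All
open import Data.List.Relation.Unary.Any using (here; there)
open import Data.List.Relation.Unary.Unique.Propositional using (Unique; []; _∷_)
open import Data.List.Relation.Unary.Unique.DecPropositional.Properties using (deduplicate-!)
open import Data.Maybe using (Maybe; just; nothing; _>>=_; _<∣>_; fromMaybe) renaming (map to mapMaybe)
open import Data.Product using (_×_; _,_; Σ-syntax; ∃; ∃₂; proj₁; proj₂; map₁; map₂)
open import Data.Sum using (inj₁; inj₂)
open import Data.Empty using (⊥-elim)
open import Data.Unit using (tt)
open import Data.Fin using (Fin; cast)
open import Data.Fin.Properties using (cast-involutive)
open import Function using (_∘_; Equivalence)
open import Relation.Binary.PropositionalEquality
open import Relation.Nullary using (Dec; yes; no; does; ⌊_⌋)
open import Relation.Nullary.Reflects using (ofʸ; ofⁿ)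
open import Relation.Nullary.Decidable using (dec-true; dec-false; toWitness; fromWitness)

open Equivalence using (to; from)

ID : VTree → Path → ℕ
ID t          []      = 0
ID (leaf _)   (_ ∷ _) = 0
ID (node l r) (L ∷ p) = suc (ID l p)
ID (node l r) (R ∷ p) = suc (#nodes l + ID r p)

ID<#nodes : ∀ t p {s} → subAt t p ≡ just s → ID t p < #nodes t
ID<#nodes (leaf _)   []      _ = s≤s z≤n
ID<#nodes (node l r) []      _ = s≤s z≤n
ID<#nodes (node l r) (L ∷ p) e = s≤s (ℕP.m≤n⇒m≤n+o (#nodes r) (ID<#nodes l p e))
ID<#nodes (node l r) (R ∷ p) e = s≤s (ℕP.+-monoʳ-< (#nodes l) (ID<#nodes r p e))

ID⁻¹∘ID : ∀ t p {s} → subAt t p ≡ just s → ID⁻¹ t (+ ID t p) ≡ just p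
ID⁻¹∘ID t          []      _ = refl
ID⁻¹∘ID (node l r) (L ∷ p) e
  with ID l p <ᵇ #nodes l | ℕP.<ᵇ-reflects-< (ID l p) (#nodes l)
... | true  | _      = cong (mapMaybe (L ∷_)) (ID⁻¹∘ID l p e)
... | false | ofⁿ ≮ = ⊥-elim (≮ (ID<#nodes l p e))
ID⁻¹∘ID (node l r) (R ∷ p) e
  with #nodes l + ID r p <ᵇ #nodes l | ℕP.<ᵇ-reflects-< (#nodes l + ID r p) (#nodes l)
... | true  | ofʸ < = ⊥-elim (ℕP.m+n≮m (#nodes l) (ID r p) <)
... | false | _
  rewrite ℕP.m+n∸m≡n (#nodes l) (ID r p) = cong (mapMaybe (R ∷_)) (ID⁻¹∘ID r p e)

⊖-+-cancel : ∀ m n → (m ⊖ n) +ℤ + n ≡ + m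
⊖-+-cancel m n = begin
  (m ⊖ n) +ℤ + n ≡⟨ ℤP.distribˡ-⊖-+-pos n m n ⟩
  m + n ⊖ n      ≡⟨ ℤP.⊖-≥ (ℕP.m≤n+m n m) ⟩
  + (m + n ∸ n)  ≡⟨ cong +_ (ℕP.m+n∸n≡m m n) ⟩
  + m            ∎
  where open ≡-Reasoning

_⊑_ : ∀ {A : Set} → List A → List A → Set
p ⊑ q = ∃ λ w → q ≡ p ++ w

Desc : Dir → Path → Path → Set
Desc D x y = ∃ λ w → y ≡ x ++ D ∷ w

_≟Dir_ : (d e : Dir) → Dec (d ≡ e)
L ≟Dir L = yes refl
R ≟Dir R = yes refl
L ≟Dir R = no λ ()
R ≟Dir L = no λ ()

_⊑?_ : (p q : Path) → Dec (p ⊑ q)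
[]      ⊑? q       = yes (q , refl)
(d ∷ p) ⊑? []      = no λ ()
(d ∷ p) ⊑? (e ∷ q) with d ≟Dir e | p ⊑? q
... | yes refl | yes (w , refl) = yes (w , refl)
... | no d≢e   | _              = no λ { (_ , refl) → d≢e refl }
... | yes refl | no p⋢q         = no λ { (w , refl) → p⋢q (w , refl) }

⊑-refl : ∀ {A : Set} (p : List A) → p ⊑ p
⊑-refl p = [] , sym (++-identityʳ p)

⊑-trans : ∀ {A : Set} {p q r : List A} → p ⊑ q → q ⊑ r → p ⊑ r
⊑-trans {p = p} (u , refl) (w , refl) = u ++ w , ++-assoc p u w

⊑⇒Desc : ∀ D x {y} → (x ++ D ∷ []) ⊑ y → Desc D x y
⊑⇒Desc D x (w , refl) = w , ++-assoc x (D ∷ []) w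

Desc⇒⊑ : ∀ D x {y} → Desc D x y → (x ++ D ∷ []) ⊑ y
Desc⇒⊑ D x (w , refl) = w , sym (++-assoc x (D ∷ []) w)

deepestProperPrefix : ∀ {A : Set} → (List A → Bool) → List A → Maybe (List A)
deepestProperPrefix ok []      = nothing
deepestProperPrefix ok (d ∷ q) =
  mapMaybe (d ∷_) (deepestProperPrefix (ok ∘ (d ∷_)) q) <∣> (if ok [] then just [] else nothing)

deepestProperPrefix-sound : ∀ {A : Set} ok (q : List A) {y} → deepestProperPrefix ok q ≡ just y →
  T (ok y) × ∃ λ d → (y ++ d ∷ []) ⊑ q
deepestProperPrefix-sound ok (d ∷ q) eq
  with deepestProperPrefix (ok ∘ (d ∷_)) q in eq′
deepestProperPrefix-sound ok (d ∷ q) refl | just y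
  with deepestProperPrefix-sound (ok ∘ (d ∷_)) q eq′
... | oky , e , w , refl = oky , e , w , refl
deepestProperPrefix-sound ok (d ∷ q) eq | nothing with ok [] in ok[]
deepestProperPrefix-sound ok (d ∷ q) refl | nothing | true = subst T (sym ok[]) tt , d , q , refl

deepestProperPrefix-maximal : ∀ {A : Set} ok {y₀ d} {q : List A} → T (ok y₀) → (y₀ ++ d ∷ []) ⊑ q →
  ∃ λ y → deepestProperPrefix ok q ≡ just y × y₀ ⊑ y
deepestProperPrefix-maximal ok {[]} {d} oky (w , refl)
  with deepestProperPrefix (ok ∘ (d ∷_)) w
... | just y  = d ∷ y , refl , d ∷ y , refl
... | nothing with ok [] | oky
...   | true | _ = [] , refl , [] , refl
deepestProperPrefix-maximal ok {e ∷ y₀} {d} oky (w , refl)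
  with deepestProperPrefix (ok ∘ (e ∷_)) ((y₀ ++ d ∷ []) ++ w)
     | deepestProperPrefix-maximal (ok ∘ (e ∷_)) {y₀} {d} oky (w , refl)
... | _ | y , refl , u , refl = e ∷ y , refl , u , refl

subAt-++ : ∀ t y {s} q → subAt t y ≡ just s → subAt t (y ++ q) ≡ subAt s q
subAt-++ t          []      q refl = refl
subAt-++ (node l r) (L ∷ y) q e    = subAt-++ l y q e
subAt-++ (node l r) (R ∷ y) q e    = subAt-++ r y q e

subAt-child : ∀ t y D {l r} → subAt t y ≡ just (node l r) → ∃ λ s → subAt t (y ++ D ∷ []) ≡ just s
subAt-child t y L {l} e = l , subAt-++ t y (L ∷ []) e
subAt-child t y R {r = r} e = r , subAt-++ t y (R ∷ []) e

subAt-properPrefix : ∀ t y {d q s} → (y ++ d ∷ []) ⊑ q → subAt t q ≡ just s →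
  ∃₂ λ l r → subAt t y ≡ just (node l r)
subAt-properPrefix (leaf _)   []      (_ , refl) ()
subAt-properPrefix (node l r) []      _          _ = l , r , refl
subAt-properPrefix (node l r) (L ∷ y) (w , refl) e = subAt-properPrefix l y (w , refl) e
subAt-properPrefix (node l r) (R ∷ y) (w , refl) e = subAt-properPrefix r y (w , refl) e

subAt-leaf∈vars : ∀ t p {X} → subAt t p ≡ just (leaf X) → X ∈ vars t
subAt-leaf∈vars (leaf _)   []      refl = here refl
subAt-leaf∈vars (node l r) (L ∷ p) e    = ∈-++⁺ˡ (subAt-leaf∈vars l p e)
subAt-leaf∈vars (node l r) (R ∷ p) e    = ∈-++⁺ʳ (vars l) (subAt-leaf∈vars r p e)

Unique-++⁻ : ∀ {A : Set} (xs : List A) {ys} → Unique (xs ++ ys) → Unique xs × Unique ys × Disjoint xs ys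
Unique-++⁻ []       u          = [] , u , λ ()
Unique-++⁻ (x ∷ xs) (x∉ ∷ u) with Unique-++⁻ xs u
... | uxs , uys , disjoint =
  All.++⁻ˡ xs x∉ ∷ uxs , uys ,
  λ { (here refl , y∈) → All.lookup (All.++⁻ʳ xs x∉) y∈ refl
    ; (there x∈ , y∈)  → disjoint (x∈ , y∈) }

leafPath : VTree → Var → Maybe Path
leafPath (leaf Y)   X = if does (X ℕP.≟ Y) then just [] else nothing
leafPath (node l r) X = mapMaybe (L ∷_) (leafPath l X) <∣> mapMaybe (R ∷_) (leafPath r X)

leafPath-∉ : ∀ t {X} → X ∉ vars t → leafPath t X ≡ nothing
leafPath-∉ (leaf Y) {X} X∉ rewrite dec-false (X ℕP.≟ Y) (X∉ ∘ here) = refl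
leafPath-∉ (node l r) X∉
  rewrite leafPath-∉ l (X∉ ∘ ∈-++⁺ˡ) | leafPath-∉ r (X∉ ∘ ∈-++⁺ʳ (vars l)) = refl

leafPath-unique : ∀ t p {X} → Unique (vars t) → subAt t p ≡ just (leaf X) → leafPath t X ≡ just p
leafPath-unique (leaf Y) [] u refl rewrite dec-true (Y ℕP.≟ Y) refl = refl
leafPath-unique (node l r) (L ∷ p) u e
  rewrite leafPath-unique l p (proj₁ (Unique-++⁻ (vars l) u)) e = refl
leafPath-unique (node l r) (R ∷ p) u e with Unique-++⁻ (vars l) u
... | _ , ur , disjoint
  rewrite leafPath-∉ l (λ X∈l → disjoint (X∈l , subAt-leaf∈vars r p e))
        | leafPath-unique r p ur e = refl

any-resp-≗ : ∀ {fs gs : List BoolFun} → Pointwise _≗_ fs gs → ∀ a → any (λ f → f a) fs ≡ any (λ f → f a) gs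
any-resp-≗ []            a = refl
any-resp-≗ (f≗g ∷ fs≗gs) a = cong₂ _∨_ (f≗g a) (any-resp-≗ fs≗gs a)

Partition-resp-≗ : ∀ {fs gs} → Pointwise _≗_ gs fs → Partition fs → Partition gs
Partition-resp-≗ {fs} {gs} gs≗fs (disjoint , covers , nonEmpty) = disjoint′ , covers′ , nonEmpty′
  where
  |gs|≡|fs| = Pointwise-length gs≗fs

  index : Fin (length gs) → Fin (length fs)
  index = cast |gs|≡|fs|

  lookup≗ : ∀ i → lookup gs i ≗ lookup fs (index i)
  lookup≗ = lookup-cast gs≗fs |gs|≡|fs|

  index-injective : ∀ {i j} → index i ≡ index j → i ≡ j
  index-injective {i} {j} eq = begin
    i                              ≡⟨ cast-involutive (sym |gs|≡|fs|) |gs|≡|fs| i ⟨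
    cast (sym |gs|≡|fs|) (index i) ≡⟨ cong (cast (sym |gs|≡|fs|)) eq ⟩
    cast (sym |gs|≡|fs|) (index j) ≡⟨ cast-involutive (sym |gs|≡|fs|) |gs|≡|fs| j ⟩
    j                              ∎
    where open ≡-Reasoning

  disjoint′ : ∀ i j → i ≢ j → ∀ a → (lookup gs i a ∧ lookup gs j a) ≡ false
  disjoint′ i j i≢j a =
    trans (cong₂ _∧_ (lookup≗ i a) (lookup≗ j a)) (disjoint _ _ (i≢j ∘ index-injective) a)

  covers′ : ∀ a → any (λ f → f a) gs ≡ true
  covers′ a = trans (any-resp-≗ gs≗fs a) (covers a)

  nonEmpty′ : ∀ i → ∃ λ a → lookup gs i a ≡ true
  nonEmpty′ i with nonEmpty (index i)
  ... | a , fa = a , trans (lookup≗ i a) fa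

sum-map-mono : ∀ {A : Set} {f g : A → ℕ} → (∀ x → f x ≤ g x) → ∀ xs → sum (map f xs) ≤ sum (map g xs)
sum-map-mono f≤g []       = z≤n
sum-map-mono f≤g (x ∷ xs) = ℕP.+-mono-≤ (f≤g x) (sum-map-mono f≤g xs)

sum-map-⊆ : ∀ {A : Set} (w : A → ℕ) {xs ys} → Unique xs → xs ⊆ ys → sum (map w xs) ≤ sum (map w ys)
sum-map-⊆ w {[]}     _          _  = z≤n
sum-map-⊆ w {x ∷ xs} (x∉ ∷ u) xs⊆ys with ∈-∃++ (xs⊆ys (here refl))
... | as , bs , refl = begin
  w x + sum (map w xs)         ≤⟨ ℕP.+-monoʳ-≤ (w x) (sum-map-⊆ w u xs⊆as++bs) ⟩
  w x + sum (map w (as ++ bs)) ≡⟨ sum-↭ (map⁺ w (shift x as bs)) ⟨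
  sum (map w (as ++ x ∷ bs))   ∎
  where
  open ℕP.≤-Reasoning
  xs⊆as++bs : xs ⊆ as ++ bs
  xs⊆as++bs {z} z∈xs with ∈-++⁻ as (xs⊆ys (there z∈xs))
  ... | inj₁ z∈as         = ∈-++⁺ˡ z∈as
  ... | inj₂ (here refl)  = ⊥-elim (All.lookup x∉ z∈xs refl)
  ... | inj₂ (there z∈bs) = ∈-++⁺ʳ as z∈bs

mutual
  hasLiteral : SDD → Bool
  hasLiteral ⊤ₛ        = false
  hasLiteral ⊥ₛ        = false
  hasLiteral (lit _ _) = true
  hasLiteral (dec es)  = hasLiteralᴱ es

  hasLiteralᴱ : List (SDD × SDD) → Bool
  hasLiteralᴱ []             = false
  hasLiteralᴱ ((p , s) ∷ es) = hasLiteral p ∨ hasLiteral s ∨ hasLiteralᴱ es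

mutual
  ⟦⟧-constant : ∀ α → hasLiteral α ≡ false → ∀ a b → ⟦ α ⟧ a ≡ ⟦ α ⟧ b
  ⟦⟧-constant ⊤ₛ       _ a b = refl
  ⟦⟧-constant ⊥ₛ       _ a b = refl
  ⟦⟧-constant (dec es) h a b = ⟦⟧ᴱ-constant es h a b

  ⟦⟧ᴱ-constant : ∀ es → hasLiteralᴱ es ≡ false → ∀ a b → ⟦ es ⟧ᴱ a ≡ ⟦ es ⟧ᴱ b
  ⟦⟧ᴱ-constant []             _ a b = refl
  ⟦⟧ᴱ-constant ((p , s) ∷ es) h a b with hasLiteral p in hp | hasLiteral s in hs
  ... | false | false =
    cong₂ _∨_ (cong₂ _∧_ (⟦⟧-constant p hp a b) (⟦⟧-constant s hs a b)) (⟦⟧ᴱ-constant es h a b)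

Respects⇒subAt : ∀ {v x} α → RespectsS v x α → ∃ λ t → subAt v x ≡ just t
Respects⇒subAt ⊤ₛ        r                 = r
Respects⇒subAt ⊥ₛ        r                 = r
Respects⇒subAt (lit _ X) r                 = leaf X , r
Respects⇒subAt (dec es)  ((l , r , e) , _) = node l r , e

module Translation (v : VTree) (wf : WellFormedVTree v) where

  -- The node of a decomposition is a proper prefix of the anchor of each child with a literal,
  -- so the search may start from the first one. The anchor of an SDD without literals is unused.
  mutual
    anchor : SDD → Path
    anchor ⊤ₛ        = []
    anchor ⊥ₛ        = []
    anchor (lit _ X) = fromMaybe [] (leafPath v X)
    anchor (dec es)  = fromMaybe [] (firstAnchor es >>= deepestProperPrefix (fits es))

    firstAnchor : List (SDD × SDD) → Maybe Path
    firstAnchor []             = nothing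
    firstAnchor ((p , s) ∷ es) =
      if hasLiteral p then just (anchor p) else if hasLiteral s then just (anchor s) else firstAnchor es

    fitsBelow : Dir → SDD → Path → Bool
    fitsBelow D p y = if hasLiteral p then ⌊ (y ++ D ∷ []) ⊑? anchor p ⌋ else true

    fits : List (SDD × SDD) → Path → Bool
    fits []             y = true
    fits ((p , s) ∷ es) y = fitsBelow L p y ∧ fitsBelow R s y ∧ fits es y

  -- A constant child may be placed at any node of the D-subtree of y.
  target : Dir → Path → SDD → Path
  target D y p = if hasLiteral p then anchor p else y ++ D ∷ []

  offset : Dir → Path → SDD → ℤ
  offset D y p = ID v (target D y p) ⊖ ID v y

  constVS : Bool → VS
  constVS b = if b then ⊤ᵥ else ⊥ᵥ

  mutual
    toVS : SDD → VS
    toVS ⊤ₛ        = ⊤ᵥ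
    toVS ⊥ₛ        = ⊥ᵥ
    toVS (lit b _) = vlit b
    toVS (dec es)  =
      if hasLiteralᴱ es then vdec (toVSᴱ (anchor (dec es)) es) else constVS (⟦ dec es ⟧ (λ _ → false))

    toVSᴱ : Path → List (SDD × SDD) → List VElem
    toVSᴱ y []             = []
    toVSᴱ y ((p , s) ∷ es) = ((toVS p , offset L y p) , (toVS s , offset R y s)) ∷ toVSᴱ y es

  key : SDD → VS × Maybe Shape
  key γ = toVS γ , mapMaybe shape (nodeAt v (+ ID v (anchor γ)))

  ⟨_,_⟩ᵥ : VS → ℤ → BoolFun
  ⟨_,_⟩ᵥ = ⟨_,_⟩ v

  record Represents (β : VS) (k : ℤ) (α : SDD) : Set where
    field
      isVS    : IsVS v β k
      sem     : ∀ a → ⟨ β , k ⟩ᵥ a ≡ ⟦ α ⟧ a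
      occ⇒key : ∀ o → o ∈ occV v β k → ∃ λ γ → γ ∈ decsS α × o ≡ key γ
  open Represents public

  Translates : ℤ → SDD → Set
  Translates k α = Represents (toVS α) k α

  Anchored : Path → SDD → Set
  Anchored x α = hasLiteral α ≡ true →
    x ⊑ anchor α × (∃ λ t → subAt v (anchor α) ≡ just t) × Translates (+ ID v (anchor α)) α

  ElemAnchored : Path → SDD × SDD → Set
  ElemAnchored x (p , s) = Anchored (x ++ L ∷ []) p × Anchored (x ++ R ∷ []) s

  Anchored-mono : ∀ {x y} α → x ⊑ y → Anchored y α → Anchored x α
  Anchored-mono α x⊑y anc h with anc h
  ... | y⊑ , valid , tr = ⊑-trans x⊑y y⊑ , valid , tr

  toVS-constant : ∀ α → hasLiteral α ≡ false → toVS α ≡ constVS (⟦ α ⟧ (λ _ → false))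
  toVS-constant ⊤ₛ       _ = refl
  toVS-constant ⊥ₛ       _ = refl
  toVS-constant (dec es) h rewrite h = refl

  constant-translates : ∀ α {k y} → hasLiteral α ≡ false → ID⁻¹ v k ≡ just y → Translates k α
  constant-translates α h valid rewrite toVS-constant α h with ⟦ α ⟧ (λ _ → false) in α₀
  ... | true  = record { isVS = _ , valid ; sem = λ a → trans (sym α₀) (⟦⟧-constant α h _ a) ; occ⇒key = λ _ () }
  ... | false = record { isVS = _ , valid ; sem = λ a → trans (sym α₀) (⟦⟧-constant α h _ a) ; occ⇒key = λ _ () }

  record ChildTranslates (D : Dir) (y : Path) (k : ℤ) (p : SDD) : Set where
    constructor childTranslates
    field
      child      : Path
      child-ID   : ID⁻¹ v k ≡ just child
      child-desc : Desc D y child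
      translates : Translates k p
  open ChildTranslates

  child-translates : ∀ D y p {x l r} → Anchored x p → subAt v y ≡ just (node l r) → T (fitsBelow D p y) →
    ChildTranslates D y (offset D y p +ℤ + ID v y) p
  child-translates D y p anc y-node fit
    rewrite ⊖-+-cancel (ID v (target D y p)) (ID v y) with hasLiteral p in h
  ... | true with anc refl
  ...   | _ , (_ , valid) , tr = childTranslates (anchor p) (ID⁻¹∘ID v (anchor p) valid) (⊑⇒Desc D y (toWitness fit)) tr
  child-translates D y p anc y-node fit | false with subAt-child v y D y-node
  ...   | _ , valid = childTranslates (y ++ D ∷ []) valid-ID ([] , refl) (constant-translates p h valid-ID)
    where valid-ID = ID⁻¹∘ID v (y ++ D ∷ []) valid

  ElemTranslates : Path → SDD × SDD → Set
  ElemTranslates y (p , s) =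
    ChildTranslates L y (offset L y p +ℤ + ID v y) p × ChildTranslates R y (offset R y s +ℤ + ID v y) s

  elements-translate : ∀ {x y l r} es → All (ElemAnchored x) es → subAt v y ≡ just (node l r) → T (fits es y) →
    All (ElemTranslates y) es
  elements-translate []             []                            y-node fit = []
  elements-translate ((p , s) ∷ es) ((anc-p , anc-s) ∷ anc-es) y-node fit
    with to T-∧ fit
  ... | fit-p , fit-rest with to T-∧ fit-rest
  ... | fit-s , fit-es =
    (child-translates L _ p anc-p y-node fit-p , child-translates R _ s anc-s y-node fit-s)
    ∷ elements-translate es anc-es y-node fit-es

  toVSᴱ-isVS : ∀ {y} es → All (ElemTranslates y) es → IsVSE v y (+ ID v y) (toVSᴱ y es)
  toVSᴱ-isVS []             []                = tt
  toVSᴱ-isVS ((p , s) ∷ es) ((tp , ts) ∷ tes) = isVSE-child tp , isVSE-child ts , toVSᴱ-isVS es tes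
    where
    isVSE-child : ∀ {D y k q} → ChildTranslates D y k q →
      Σ[ z ∈ Path ] ID⁻¹ v k ≡ just z × Desc D y z × IsVS v (toVS q) k
    isVSE-child t = child t , child-ID t , child-desc t , isVS (translates t)

  toVSᴱ-sem : ∀ {y} es → All (ElemTranslates y) es → ∀ a → ⟨_,_⟩ᴱ v (toVSᴱ y es) (+ ID v y) a ≡ ⟦ es ⟧ᴱ a
  toVSᴱ-sem []             []                a = refl
  toVSᴱ-sem ((p , s) ∷ es) ((tp , ts) ∷ tes) a =
    cong₂ _∨_ (cong₂ _∧_ (sem (translates tp) a) (sem (translates ts) a)) (toVSᴱ-sem es tes a)

  toVSᴱ-primes : ∀ {y} es → All (ElemTranslates y) es → Pointwise _≗_ (primesV v (toVSᴱ y es) (+ ID v y)) (primesS es)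
  toVSᴱ-primes []             []                = []
  toVSᴱ-primes ((p , s) ∷ es) ((tp , ts) ∷ tes) = sem (translates tp) ∷ toVSᴱ-primes es tes

  toVSᴱ-occ⇒key : ∀ y es → All (ElemTranslates y) es →
    ∀ o → o ∈ occE v (toVSᴱ y es) (+ ID v y) → ∃ λ γ → γ ∈ decsE es × o ≡ key γ
  toVSᴱ-occ⇒key y ((p , s) ∷ es) ((tp , ts) ∷ tes) o o∈
    with ∈-++⁻ (occV v (toVS p) (offset L y p +ℤ + ID v y)) o∈
  ... | inj₁ o∈p with occ⇒key (translates tp) o o∈p
  ...   | γ , γ∈ , eq = γ , ∈-++⁺ˡ γ∈ , eq
  toVSᴱ-occ⇒key y ((p , s) ∷ es) ((tp , ts) ∷ tes) o o∈ | inj₂ o∈rest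
    with ∈-++⁻ (occV v (toVS s) (offset R y s +ℤ + ID v y)) o∈rest
  ... | inj₁ o∈s with occ⇒key (translates ts) o o∈s
  ...   | γ , γ∈ , eq = γ , ∈-++⁺ʳ (decsS p) (∈-++⁺ˡ γ∈) , eq
  toVSᴱ-occ⇒key y ((p , s) ∷ es) ((tp , ts) ∷ tes) o o∈ | inj₂ _ | inj₂ o∈es
    with toVSᴱ-occ⇒key y es tes o o∈es
  ...   | γ , γ∈ , eq = γ , ∈-++⁺ʳ (decsS p) (∈-++⁺ʳ (decsS s) γ∈) , eq

  fitsBelow-anchored : ∀ D x p → Anchored (x ++ D ∷ []) p → T (fitsBelow D p x)
  fitsBelow-anchored D x p anc with hasLiteral p in h
  ... | true  = fromWitness (proj₁ (anc refl))
  ... | false = tt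

  fits-anchored : ∀ {x} es → All (ElemAnchored x) es → T (fits es x)
  fits-anchored []             []                = tt
  fits-anchored ((p , s) ∷ es) ((anc-p , anc-s) ∷ anc-es) =
    from T-∧ (fitsBelow-anchored L _ p anc-p , from T-∧ (fitsBelow-anchored R _ s anc-s , fits-anchored es anc-es))

  firstAnchor-anchored : ∀ {x} es → hasLiteralᴱ es ≡ true → All (ElemAnchored x) es →
    ∃ λ q → firstAnchor es ≡ just q × (∃ λ d → (x ++ d ∷ []) ⊑ q) × ∃ λ t → subAt v q ≡ just t
  firstAnchor-anchored ((p , s) ∷ es) h ((anc-p , anc-s) ∷ anc-es) with hasLiteral p in hp
  ... | true  = anchor p , refl , (L , proj₁ (anc-p refl)) , proj₁ (proj₂ (anc-p refl))
  ... | false with hasLiteral s in hs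
  ...   | true  = anchor s , refl , (R , proj₁ (anc-s refl)) , proj₁ (proj₂ (anc-s refl))
  ...   | false = firstAnchor-anchored es h anc-es

  toVS-dec : ∀ {y} es → hasLiteralᴱ es ≡ true → anchor (dec es) ≡ y → toVS (dec es) ≡ vdec (toVSᴱ y es)
  toVS-dec es h refl rewrite h = refl

  dec-translates : ∀ {y l r} es → hasLiteralᴱ es ≡ true → anchor (dec es) ≡ y → subAt v y ≡ just (node l r) →
    All (ElemTranslates y) es → Partition (primesS es) → Translates (+ ID v y) (dec es)
  dec-translates {y} {l} {r} es h anchor≡y y-node tes part rewrite toVS-dec es h anchor≡y = record
    { isVS    = y , ID⁻¹∘ID v y y-node , (l , r , y-node) , toVSᴱ-isVS es tes
              , Partition-resp-≗ (toVSᴱ-primes es tes) part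
    ; sem     = toVSᴱ-sem es tes
    ; occ⇒key = λ { o (here refl) → dec es , here refl , key-dec
                  ; o (there o∈)  → map₂ (map₁ there) (toVSᴱ-occ⇒key y es tes o o∈) }
    }
    where
    key-dec : (vdec (toVSᴱ y es) , mapMaybe shape (nodeAt v (+ ID v y))) ≡ key (dec es)
    key-dec = cong₂ _,_ (sym (toVS-dec es h anchor≡y))
                        (cong (λ z → mapMaybe shape (nodeAt v (+ ID v z))) (sym anchor≡y))

  dec-anchored : ∀ {x} es → All (ElemAnchored x) es → Partition (primesS es) → Anchored x (dec es)
  dec-anchored {x} es anc-es part h
    with firstAnchor-anchored es h anc-es
  ... | q , q-first , (_ , x⊏q) , (_ , q-valid)
    with deepestProperPrefix-maximal (fits es) (fits-anchored es anc-es) x⊏q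
  ... | y , y-deepest , x⊑y
    with deepestProperPrefix-sound (fits es) q y-deepest
  ... | y-fits , _ , y⊏q
    with subAt-properPrefix v y y⊏q q-valid
  ... | l , r , y-node =
    subst (λ z → x ⊑ z × (∃ λ t → subAt v z ≡ just t) × Translates (+ ID v z) (dec es)) (sym anchor≡y)
      (x⊑y , (node l r , y-node) ,
       dec-translates es h anchor≡y y-node (elements-translate es anc-es y-node y-fits) part)
    where
    anchor≡y : anchor (dec es) ≡ y
    anchor≡y = cong (fromMaybe []) (trans (cong (_>>= deepestProperPrefix (fits es)) q-first) y-deepest)

  literal-anchored : ∀ {x} b X → subAt v x ≡ just (leaf X) → Anchored x (lit b X)
  literal-anchored {x} b X x-leaf _ =
    subst (λ z → x ⊑ z × (∃ λ t → subAt v z ≡ just t) × Translates (+ ID v z) (lit b X)) (sym anchor≡x)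
      (⊑-refl x , (leaf X , x-leaf) , record { isVS = X , x-node ; sem = sem-lit ; occ⇒key = λ _ () })
    where
    anchor≡x : anchor (lit b X) ≡ x
    anchor≡x = cong (fromMaybe []) (leafPath-unique v x wf x-leaf)
    x-node : nodeAt v (+ ID v x) ≡ just (leaf X)
    x-node = trans (cong (_>>= subAt v) (ID⁻¹∘ID v x x-leaf)) x-leaf
    sem-lit : ∀ a → ⟨ vlit b , + ID v x ⟩ᵥ a ≡ ⟦ lit b X ⟧ a
    sem-lit a rewrite x-node = refl

  mutual
    anchored : ∀ {x} α → RespectsS v x α → Anchored x α
    anchored ⊤ₛ        _                ()
    anchored ⊥ₛ        _                ()
    anchored (lit b X) x-leaf           = literal-anchored b X x-leaf
    anchored (dec es)  (_ , res , part) = dec-anchored es (anchoredᴱ es res) part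

    anchoredᴱ : ∀ {x} es → RespectsE v x es → All (ElemAnchored x) es
    anchoredᴱ []             _                                                 = []
    anchoredᴱ ((p , s) ∷ es) ((_ , p-desc , rp) , (_ , s-desc , rs) , res) =
      (Anchored-mono p (Desc⇒⊑ L _ p-desc) (anchored p rp) ,
       Anchored-mono s (Desc⇒⊑ R _ s-desc) (anchored s rs))
      ∷ anchoredᴱ es res

  length-toVSᴱ : ∀ y es → length (toVSᴱ y es) ≡ length es
  length-toVSᴱ y []       = refl
  length-toVSᴱ y (_ ∷ es) = cong suc (length-toVSᴱ y es)

  key-size : ∀ γ → #elemsV (proj₁ (key γ)) ≤ #elemsS γ
  key-size ⊤ₛ        = z≤n
  key-size ⊥ₛ        = z≤n
  key-size (lit _ _) = z≤n
  key-size (dec es) with hasLiteralᴱ es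
  ... | true = ℕP.≤-reflexive (length-toVSᴱ (anchor (dec es)) es)
  ... | false with ⟦ dec es ⟧ (λ _ → false)
  ...   | true  = z≤n
  ...   | false = z≤n

  size-bound : ∀ {β k} α → (∀ o → o ∈ occV v β k → ∃ λ γ → γ ∈ decsS α × o ≡ key γ) → sizeV v β k ≤ sizeS α
  size-bound {β} {k} α occ⇒key = begin
    sum (map weight (deduplicate _≟occ_ occs))         ≤⟨ sum-map-⊆ weight (deduplicate-! _≟occ_ occs) occs⊆keys ⟩
    sum (map weight (map key (deduplicate _≟S_ decs)))  ≡⟨ cong sum (map-∘ (deduplicate _≟S_ decs)) ⟨
    sum (map (weight ∘ key) (deduplicate _≟S_ decs))    ≤⟨ sum-map-mono key-size (deduplicate _≟S_ decs) ⟩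
    sizeS α                                            ∎
    where
    open ℕP.≤-Reasoning
    weight : VS × Maybe Shape → ℕ
    weight o = #elemsV (proj₁ o)
    occs = occV v β k
    decs = decsS α
    occs⊆keys : deduplicate _≟occ_ occs ⊆ map key (deduplicate _≟S_ decs)
    occs⊆keys o∈ with occ⇒key _ (∈-deduplicate⁻ _≟occ_ occs o∈)
    ... | γ , γ∈ , refl = ∈-map⁺ key (∈-deduplicate⁺ _≟S_ γ∈)

  translation : ∀ {x} α → RespectsS v x α → Σ[ k ∈ ℤ ] Translates k α
  translation {x} α rα with hasLiteral α in h
  ... | true  = + ID v (anchor α) , proj₂ (proj₂ (anchored α rα h))
  ... | false = + ID v x , constant-translates α h (ID⁻¹∘ID v x (proj₂ (Respects⇒subAt α rα)))

proposition1 : (v : VTree) → WellFormedVTree v → (x : Path) → (α : SDD) → RespectsS v x α →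
    Σ[ β ∈ VS ] Σ[ k ∈ ℤ ] IsVS v β k × (∀ a → ⟨_,_⟩ v β k a ≡ ⟦ α ⟧ a) × sizeV v β k ≤ sizeS α
proposition1 v wf x α rα =
  let k , t = translation α rα in toVS α , k , isVS t , sem t , size-bound α (occ⇒key t)
  where open Translation v wf
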